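{- For any formulas $\theta,\phi,\psi$: if $\phi$ and $\psi$ are strongly equivalent, then $\theta[\phi/p]$ and $\theta[\psi/p]$ are strongly equivalent.
   Context: Fix a countably infinite set $\mathsf{Prop}$ of propositional variables. Formulas of $\mathsf{BSML}$ are generated by $\phi ::= p \mid \neg\phi \mid (\phi\wedge\phi) \mid (\phi\vee\phi) \mid \Diamond\phi \mid \mathrm{NE}$ ($p\in\mathsf{Prop}$); $\mathsf{BSML}^{\sqcup}$ adds the global disjunction $\phi\sqcup\phi$, and $\mathsf{BSML}^{\oslash}$ adds the emptiness operator $\oslash\phi$; formulas here range over these logics. A Kripke model is $M=(W,R,V)$ with $W\neq\emptyset$, $R\subseteq W\times W$, $V$ a valuation; a state is any $s\subseteq W$, $R[w]=\{v\mid wRv\}$. Support $M,s\vDash\phi$ and anti-support $M,s\mathrel{=\!\!\mid}\phi$: $s\vDash p$ iff $w\in V(p)$ for all $w\in s$; $s\mathrel{=\!\!\mid} p$ iff $w\notin V(p)$ for all $w\in s$; $s\vDash\mathrm{NE}$ iff $s\neq\emptyset$; $s\mathrel{=\!\!\mid}\mathrm{NE}$ iff $s=\emptyset$; $s\vDash\neg\phi$ iff $s\mathrel{=\!\!\mid}\phi$; $s\mathrel{=\!\!\mid}\neg\phi$ iff $s\vDash\phi$; $s\vDash\phi\wedge\psi$ iff $s\vDash\phi$ and $s\vDash\psi$; $s\mathrel{=\!\!\mid}\phi\wedge\psi$ iff $s=t\cup u$ with $t\mathrel{=\!\!\mid}\phi$, $u\mathrel{=\!\!\mid}\psi$; $s\vDash\phi\vee\psi$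 iff $s=t\cup u$ with $t\vDash\phi$, $u\vDash\psi$; $s\mathrel{=\!\!\mid}\phi\vee\psi$ iff $s\mathrel{=\!\!\mid}\phi$ and $s\mathrel{=\!\!\mid}\psi$; $s\vDash\phi\sqcup\psi$ iff $s\vDash\phi$ or $s\vDash\psi$; $s\mathrel{=\!\!\mid}\phi\sqcup\psi$ iff $s\mathrel{=\!\!\mid}\phi$ and $s\mathrel{=\!\!\mid}\psi$; $s\vDash\Diamond\phi$ iff for every $w\in s$ there is a nonempty $t\subseteq R[w]$ with $t\vDash\phi$; $s\mathrel{=\!\!\mid}\Diamond\phi$ iff $R[w]\mathrel{=\!\!\mid}\phi$ for all $w\in s$; $s\vDash\oslash\phi$ iff $s\vDash\phi$ or $s=\emptyset$; $s\mathrel{=\!\!\mid}\oslash\phi$ iff $s\mathrel{=\!\!\mid}\phi$. $\phi\equiv\psi$ means $\phi$ and $\psi$ are supported by exactly the same $M,s$; $\phi$ and $\psi$ are strongly equivalent if $\phi\equiv\psi$ and $\neg\phi\equiv\neg\psi$. $\theta[\phi/p]$ denotes the result of replacing (a specified occurrence of) $p$ in $\theta$ by $\phi$. -}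

module Defs where

open import Level using (Level) renaming (suc to lsuc; zero to lzero)
open import Data.Nat using (ℕ)
open import Data.Product using (Σ; ∃; _×_; _,_)
open import Data.Sum using (_⊎_)
open import Data.Empty using (⊥)
open import Relation.Nullary using (¬_)
open import Function.Bundles using (_⇔_)

Prop : Set
Prop = ℕ

-- Formulas of the union language BSML + ⊔ + ⊘ (covers BSML, BSML^⊔, BSML^⊘).
data Form : Set where
  var  : Prop → Form
  ¬′_  : Form → Form
  _∧′_ : Form → Form → Form
  _∨′_ : Form → Form → Form
  ◇_   : Form → Form
  NE   : Form
  _⊔′_ : Form → Form → Form
  ⊘_   : Form → Form

record Model : Set₁ where
  field
    W      : Set
    inhab  : W
    R      : W → W → Set
    V      : Prop → W → Set

Lift′ : Set → Set₁
Lift′ A = Level.Lift (lsuc lzero) A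

State : Model → Set₁
State M = Model.W M → Set

module _ (M : Model) where
  open Model M

  _⊆_ : State M → State M → Set
  s ⊆ t = ∀ w → s w → t w

  IsUnion : State M → State M → State M → Set
  IsUnion s t u = ∀ w → s w ⇔ (t w ⊎ u w)

  Empty : State M → Set
  Empty s = ∀ w → ¬ s w

  NonEmpty : State M → Set
  NonEmpty s = ∃ λ w → s w

  R[_] : W → State M
  R[ w ] v = R w v

  mutual
    _⊨_ : State M → Form → Set₁
    s ⊨ var p = Lift′ (∀ w → s w → V p w)
    s ⊨ (¬′ φ) = s ⫤ φ
    s ⊨ (φ ∧′ ψ) = (s ⊨ φ) × (s ⊨ ψ)
    s ⊨ (φ ∨′ ψ) = Σ (State M) λ t → Σ (State M) λ u →
                     IsUnion s t u × (t ⊨ φ) × (u ⊨ ψ)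
    s ⊨ (◇ φ) = ∀ w → s w → Σ (State M) λ t →
                     (t ⊆ R[ w ]) × NonEmpty t × (t ⊨ φ)
    s ⊨ NE = Lift′ (NonEmpty s)
    s ⊨ (φ ⊔′ ψ) = (s ⊨ φ) ⊎ (s ⊨ ψ)
    s ⊨ (⊘ φ) = (s ⊨ φ) ⊎ Lift′ (Empty s)

    _⫤_ : State M → Form → Set₁
    s ⫤ var p = Lift′ (∀ w → s w → ¬ V p w)
    s ⫤ (¬′ φ) = s ⊨ φ
    s ⫤ (φ ∧′ ψ) = Σ (State M) λ t → Σ (State M) λ u →
                     IsUnion s t u × (t ⫤ φ) × (u ⫤ ψ)
    s ⫤ (φ ∨′ ψ) = (s ⫤ φ) × (s ⫤ ψ)
    s ⫤ (◇ φ) = ∀ w → s w → R[ w ] ⫤ φ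
    s ⫤ NE = Lift′ (Empty s)
    s ⫤ (φ ⊔′ ψ) = (s ⫤ φ) × (s ⫤ ψ)
    s ⫤ (⊘ φ) = s ⫤ φ

_≡ᶠ_ : Form → Form → Set₁
φ ≡ᶠ ψ = (M : Model) (s : State M) → (_⊨_ M s φ) ⇔ (_⊨_ M s ψ)

StronglyEquivalent : Form → Form → Set₁
StronglyEquivalent φ ψ = (φ ≡ᶠ ψ) × ((¬′ φ) ≡ᶠ (¬′ ψ))

-- One-hole formula contexts: a formula θ with one specified occurrence of
-- a variable p is  plug C (var p);  θ[φ/p] is then  plug C φ.
data Ctx : Set where
  hole  : Ctx
  ¬c_   : Ctx → Ctx
  _∧l_  : Ctx → Form → Ctx
  _∧r_  : Form → Ctx → Ctx
  _∨l_  : Ctx → Form → Ctx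
  _∨r_  : Form → Ctx → Ctx
  ◇c_   : Ctx → Ctx
  _⊔l_  : Ctx → Form → Ctx
  _⊔r_  : Form → Ctx → Ctx
  ⊘c_   : Ctx → Ctx

plug : Ctx → Form → Form
plug hole φ = φ
plug (¬c C) φ = ¬′ plug C φ
plug (C ∧l χ) φ = plug C φ ∧′ χ
plug (χ ∧r C) φ = χ ∧′ plug C φ
plug (C ∨l χ) φ = plug C φ ∨′ χ
plug (χ ∨r C) φ = χ ∨′ plug C φ
plug (◇c C) φ = ◇ plug C φ
plug (C ⊔l χ) φ = plug C φ ⊔′ χ
plug (χ ⊔r C) φ = χ ⊔′ plug C φ
plug (⊘c C) φ = ⊘ plug C φ

_[_/_]at_ : Form → Form → Prop → Ctx → Form
θ [ φ / p ]at C = plug C φ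

{-# OPTIONS --safe #-}
module Submission where

-- Support and anti-support of a compound formula depend positively on the
-- support and anti-support of its immediate subformulas (negation merely
-- swaps the two).  Hence the preorder "φ strongly entails ψ" -- every state
-- supporting (anti-supporting) φ supports (anti-supports) ψ -- is preserved
-- by every connective and so by every one-hole context; strong equivalence
-- is strong entailment in both directions.

open import Defs
open import Relation.Binary.PropositionalEquality using (_≡_)
open import Data.Product using (_,_)
open import Data.Sum using (inj₁; inj₂)
open import Function.Bundles using (mk⇔; Equivalence)

record _⇛_ (φ ψ : Form) : Set₁ where
  field
    support     : ∀ M s → _⊨_ M s φ → _⊨_ M s ψ
    antisupport : ∀ M s → _⫤_ M s φ → _⫤_ M s ψ
open _⇛_

⇛-refl : ∀ {φ} → φ ⇛ φ
⇛-refl .support     M s x = x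
⇛-refl .antisupport M s x = x

¬-mono : ∀ {φ φ′} → φ ⇛ φ′ → (¬′ φ) ⇛ (¬′ φ′)
¬-mono e .support     = e .antisupport
¬-mono e .antisupport = e .support

∧-mono : ∀ {φ φ′ ψ ψ′} → φ ⇛ φ′ → ψ ⇛ ψ′ → (φ ∧′ ψ) ⇛ (φ′ ∧′ ψ′)
∧-mono e f .support M s (x , y) = e .support M s x , f .support M s y
∧-mono e f .antisupport M s (t , u , s≡t∪u , x , y) =
  t , u , s≡t∪u , e .antisupport M t x , f .antisupport M u y

∨-mono : ∀ {φ φ′ ψ ψ′} → φ ⇛ φ′ → ψ ⇛ ψ′ → (φ ∨′ ψ) ⇛ (φ′ ∨′ ψ′)
∨-mono e f .support M s (t , u , s≡t∪u , x , y) =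
  t , u , s≡t∪u , e .support M t x , f .support M u y
∨-mono e f .antisupport M s (x , y) = e .antisupport M s x , f .antisupport M s y

◇-mono : ∀ {φ φ′} → φ ⇛ φ′ → (◇ φ) ⇛ (◇ φ′)
◇-mono e .support M s h w w∈s with h w w∈s
... | t , t⊆R[w] , t≠∅ , x = t , t⊆R[w] , t≠∅ , e .support M t x
◇-mono e .antisupport M s h w w∈s = e .antisupport M _ (h w w∈s)

⊔-mono : ∀ {φ φ′ ψ ψ′} → φ ⇛ φ′ → ψ ⇛ ψ′ → (φ ⊔′ ψ) ⇛ (φ′ ⊔′ ψ′)
⊔-mono e f .support M s (inj₁ x) = inj₁ (e .support M s x)
⊔-mono e f .support M s (inj₂ y) = inj₂ (f .support M s y)
⊔-mono e f .antisupport M s (x , y) = e .antisupport M s x , f .antisupport M s y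

⊘-mono : ∀ {φ φ′} → φ ⇛ φ′ → (⊘ φ) ⇛ (⊘ φ′)
⊘-mono e .support M s (inj₁ x)   = inj₁ (e .support M s x)
⊘-mono e .support M s (inj₂ s=∅) = inj₂ s=∅
⊘-mono e .antisupport = e .antisupport

plug-mono : ∀ C {φ ψ} → φ ⇛ ψ → plug C φ ⇛ plug C ψ
plug-mono hole     e = e
plug-mono (¬c C)   e = ¬-mono (plug-mono C e)
plug-mono (C ∧l χ) e = ∧-mono (plug-mono C e) ⇛-refl
plug-mono (χ ∧r C) e = ∧-mono ⇛-refl (plug-mono C e)
plug-mono (C ∨l χ) e = ∨-mono (plug-mono C e) ⇛-refl
plug-mono (χ ∨r C) e = ∨-mono ⇛-refl (plug-mono C e)
plug-mono (◇c C)   e = ◇-mono (plug-mono C e)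
plug-mono (C ⊔l χ) e = ⊔-mono (plug-mono C e) ⇛-refl
plug-mono (χ ⊔r C) e = ⊔-mono ⇛-refl (plug-mono C e)
plug-mono (⊘c C)   e = ⊘-mono (plug-mono C e)

StronglyEquivalent⇒⇛ : ∀ {φ ψ} → StronglyEquivalent φ ψ → φ ⇛ ψ
StronglyEquivalent⇒⇛ (φ≡ψ , ¬φ≡¬ψ) .support     M s = Equivalence.to (φ≡ψ M s)
StronglyEquivalent⇒⇛ (φ≡ψ , ¬φ≡¬ψ) .antisupport M s = Equivalence.to (¬φ≡¬ψ M s)

StronglyEquivalent-sym : ∀ {φ ψ} → StronglyEquivalent φ ψ → StronglyEquivalent ψ φ
StronglyEquivalent-sym (φ≡ψ , ¬φ≡¬ψ) =
  (λ M s → mk⇔ (Equivalence.from (φ≡ψ M s)) (Equivalence.to (φ≡ψ M s))) ,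
  (λ M s → mk⇔ (Equivalence.from (¬φ≡¬ψ M s)) (Equivalence.to (¬φ≡¬ψ M s)))

⇛-antisym : ∀ {φ ψ} → φ ⇛ ψ → ψ ⇛ φ → StronglyEquivalent φ ψ
⇛-antisym φ⇛ψ ψ⇛φ =
  (λ M s → mk⇔ (φ⇛ψ .support M s) (ψ⇛φ .support M s)) ,
  (λ M s → mk⇔ (φ⇛ψ .antisupport M s) (ψ⇛φ .antisupport M s))

proposition2p4 : (θ φ ψ : Form) (p : Prop) (C : Ctx) →
    θ ≡ plug C (var p) →
    StronglyEquivalent φ ψ →
    StronglyEquivalent (θ [ φ / p ]at C) (θ [ ψ / p ]at C)
proposition2p4 θ φ ψ p C _ φ≋ψ =
  ⇛-antisym (plug-mono C (StronglyEquivalent⇒⇛ φ≋ψ))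
            (plug-mono C (StronglyEquivalent⇒⇛ (StronglyEquivalent-sym {φ} {ψ} φ≋ψ)))
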